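{- For every $\beta\in\Omega$, every $k\in\mathbb{N}$ and every $x\in\mathbb{N}$: $G_{\phi_k(\beta)}(x)=Q_k(x,G_\beta(x))$ and $L_{\phi_k(\beta)}(x)\le H_k(x,L_\beta(x))$. Consequently, $G_\alpha$ is monotone for every $\alpha\in\Phi_\omega$.
   Context: Constructive ordinals: $\Omega$ is the set of infinitary terms generated by $0$, successor $\alpha+1$, and limits $\langle\alpha_i\rangle_{i\in\mathbb{N}}$. $o(0)=0$, $o(n+1)=o(n)+1$, $\omega=\langle o(i+1)\rangle_i$. Arithmetic: $\alpha+0=\alpha$, $\alpha+(\beta+1)=(\alpha+\beta)+1$, $\alpha+\langle\beta_i\rangle=\langle\alpha+\beta_i\rangle$; $\alpha\cdot0=0$, $\alpha\cdot(\beta+1)=\alpha\cdot\beta+\alpha$, $\alpha\cdot\langle\beta_i\rangle=\langle\alpha\cdot\beta_i\rangle$; $\alpha^0=o(1)$, $\alpha^{\beta+1}=\alpha^\beta\cdot\alpha$, $\alpha^{\langle\beta_i\rangle}=\langle\alpha^{\beta_i}\rangle$. Veblen functions: $\phi_0(\gamma)=\omega^\gamma$; $\phi_{k+1}(0)=\langle\phi_k^{(i)}(0)\rangle_i$; $\phi_{k+1}(\gamma+1)=\langle\phi_k^{(i)}(\phi_{k+1}(\gamma)+1)\rangle_i$; $\phi_{k+1}(\langle\gamma_i\rangle)=\langle\phi_{k+1}(\gamma_i)\rangle_i$. $\Phi_\omega$: smallest set containing $0$ closed under $+$ and all $\phi_i$. Slow-growing hierarchy: $G_0(n)=0$, $G_{\alpha+1}(n)=G_\alpha(n)+1$,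 $G_{\langle\alpha_i\rangle}(n)=G_{\alpha_n}(n)$. Length hierarchy: $L_0(n)=0$, $L_{\alpha+1}(n)=L_\alpha(n)+1$, $L_{\langle\alpha_i\rangle}(n)=L_{\alpha_n}(n)+1$. Numeral functions: $Q_0(x,y)=(x+1)^y$, $Q_{k+1}(x,0)=Q_k^{(x)}(x,0)$, $Q_{k+1}(x,y+1)=Q_k^{(x)}(x,Q_{k+1}(x,y)+1)$; $H_0(x,y)=(x+2)^y$, $H_{k+1}(x,0)=H_k^{(x)}(x,0)+1$, $H_{k+1}(x,y+1)=H_k^{(x)}(x,H_{k+1}(x,y)+1)+1$, where $Q_k^{(x)}$, $H_k^{(x)}$ denote $x$-fold iteration in the second argument (first argument fixed). -}

module Defs where

open import Data.Nat as ℕ using (ℕ; _≤_)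
import Data.Nat as N

data Ω : Set where
  zero : Ω
  suc  : Ω → Ω
  lim  : (ℕ → Ω) → Ω

o : ℕ → Ω
o N.zero    = zero
o (N.suc n) = suc (o n)

ω : Ω
ω = lim (λ i → o (N.suc i))

infixl 6 _⊕_
infixl 7 _⊗_
infixr 8 _⊛_

_⊕_ : Ω → Ω → Ω
α ⊕ zero    = α
α ⊕ suc β   = suc (α ⊕ β)
α ⊕ lim f   = lim (λ i → α ⊕ f i)

_⊗_ : Ω → Ω → Ω
α ⊗ zero    = zero
α ⊗ suc β   = (α ⊗ β) ⊕ α
α ⊗ lim f   = lim (λ i → α ⊗ f i)

_⊛_ : Ω → Ω → Ω
α ⊛ zero    = o 1
α ⊛ suc β   = (α ⊛ β) ⊗ α
α ⊛ lim f   = lim (λ i → α ⊛ f i)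

iter : {A : Set} → (A → A) → ℕ → A → A
iter f N.zero    a = a
iter f (N.suc n) a = f (iter f n a)

φ : ℕ → Ω → Ω
φ N.zero    γ       = ω ⊛ γ
φ (N.suc k) zero    = lim (λ i → iter (φ k) i zero)
φ (N.suc k) (suc γ) = lim (λ i → iter (φ k) i (suc (φ (N.suc k) γ)))
φ (N.suc k) (lim f) = lim (λ i → φ (N.suc k) (f i))

data Φω : Ω → Set where
  Φ-zero : Φω zero
  Φ-add  : ∀ {α β} → Φω α → Φω β → Φω (α ⊕ β)
  Φ-phi  : ∀ {α} (i : ℕ) → Φω α → Φω (φ i α)

G : Ω → ℕ → ℕ
G zero    n = 0
G (suc α) n = N.suc (G α n)
G (lim f) n = G (f n) n

L : Ω → ℕ → ℕ
L zero    n = 0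
L (suc α) n = N.suc (L α n)
L (lim f) n = N.suc (L (f n) n)

Q : ℕ → ℕ → ℕ → ℕ
Q N.zero    x y         = (N.suc x) N.^ y
Q (N.suc k) x N.zero    = iter (Q k x) x 0
Q (N.suc k) x (N.suc y) = iter (Q k x) x (N.suc (Q (N.suc k) x y))

H : ℕ → ℕ → ℕ → ℕ
H N.zero    x y         = (N.suc (N.suc x)) N.^ y
H (N.suc k) x N.zero    = N.suc (iter (H k x) x 0)
H (N.suc k) x (N.suc y) = N.suc (iter (H k x) x (N.suc (H (N.suc k) x y)))

Monotone : (ℕ → ℕ) → Set
Monotone f = ∀ x y → x ≤ y → f x ≤ f y

-- G is a homomorphism from the ordinal arithmetic of Ω to that of ℕ at every argument x
-- (with G ω = x + 1), so G ∘ φ k obeys the recursion defining Q k, and the equation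
-- follows by induction on k and β. For L, the limit steps of ω ⊛ β and of φ k β each add 1,
-- which H k absorbs because H k x is monotone and inflationary. Monotonicity of G on Φω
-- then reduces to monotonicity of + and of Q k in both arguments.
module Submission where

open import Defs
open import Data.Nat using (ℕ; _≤_)
open import Data.Product using (_×_)
open import Relation.Binary.PropositionalEquality using (_≡_)

open import Data.Nat using (zero; suc; _+_; _*_; _^_; _<_; z≤n; s≤s; _≤′_; ≤′-refl; ≤′-step)
open import Data.Nat.Properties
open import Data.Product using (_,_)
open import Relation.Binary.PropositionalEquality using (refl; cong; sym; trans; module ≡-Reasoning)

private
  variable
    x x′ y y′ a b : ℕ

iter-inflationary : {g : ℕ → ℕ} → (∀ c → c ≤ g c) → ∀ n b → b ≤ iter g n b
iter-inflationary infl zero    b = ≤-refl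
iter-inflationary infl (suc n) b = ≤-trans (iter-inflationary infl n b) (infl _)

iter-mono-count : {g : ℕ → ℕ} {n m b : ℕ} → (∀ c → c ≤ g c) → n ≤ m → iter g n b ≤ iter g m b
iter-mono-count {g} {b = b} infl n≤m = go (≤⇒≤′ n≤m)
  where
  go : ∀ {n m} → n ≤′ m → iter g n b ≤ iter g m b
  go ≤′-refl        = ≤-refl
  go (≤′-step n≤′m) = ≤-trans (go n≤′m) (infl _)

iter-mono : {f g : ℕ → ℕ} → (∀ {c d} → c ≤ d → f c ≤ g d) →
            ∀ n → a ≤ b → iter f n a ≤ iter g n b
iter-mono f≤g zero    a≤b = a≤b
iter-mono f≤g (suc n) a≤b = f≤g (iter-mono f≤g n a≤b)

iter-map : {A : Set} {F : A → A} {f : ℕ → ℕ} (h : A → ℕ) →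
           (∀ a → h (F a) ≡ f (h a)) → ∀ n a → h (iter F n a) ≡ iter f n (h a)
iter-map h comm zero    a = refl
iter-map {f = f} h comm (suc n) a = trans (comm _) (cong f (iter-map h comm n a))

iter-map-≤ : {A : Set} {F : A → A} {f : ℕ → ℕ} (h : A → ℕ) →
             (∀ a → h (F a) ≤ f (h a)) → (∀ {c d} → c ≤ d → f c ≤ f d) →
             ∀ n a → h (iter F n a) ≤ iter f n (h a)
iter-map-≤ h h∘F≤f∘h f-mono zero    a = ≤-refl
iter-map-≤ h h∘F≤f∘h f-mono (suc n) a = ≤-trans (h∘F≤f∘h _) (f-mono (iter-map-≤ h h∘F≤f∘h f-mono n a))

mono-from-step : (f : ℕ → ℕ) → (∀ y → f y ≤ f (suc y)) → y ≤ y′ → f y ≤ f y′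
mono-from-step f step y≤y′ = go (≤⇒≤′ y≤y′)
  where
  go : ∀ {y y′} → y ≤′ y′ → f y ≤ f y′
  go ≤′-refl         = ≤-refl
  go (≤′-step y≤′y′) = ≤-trans (go y≤′y′) (step _)

n<[2+m]^n : ∀ m n → n < suc (suc m) ^ n
n<[2+m]^n m zero    = s≤s z≤n
n<[2+m]^n m (suc n) = ≤-trans (s≤s (n<[2+m]^n m n)) (^-monoʳ-< (suc (suc m)) (s≤s (s≤s z≤n)) (n<1+n n))

G-⊕ : ∀ α β x → G (α ⊕ β) x ≡ G α x + G β x
G-⊕ α zero    x = sym (+-identityʳ _)
G-⊕ α (suc β) x = trans (cong suc (G-⊕ α β x)) (sym (+-suc _ _))
G-⊕ α (lim f) x = G-⊕ α (f x) x

G-⊗ : ∀ α β x → G (α ⊗ β) x ≡ G α x * G β x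
G-⊗ α zero    x = sym (*-zeroʳ (G α x))
G-⊗ α (suc β) x = begin
  G (α ⊗ β ⊕ α) x       ≡⟨ G-⊕ (α ⊗ β) α x ⟩
  G (α ⊗ β) x + G α x   ≡⟨ cong (_+ G α x) (G-⊗ α β x) ⟩
  G α x * G β x + G α x ≡⟨ +-comm _ (G α x) ⟩
  G α x + G α x * G β x ≡⟨ sym (*-suc (G α x) (G β x)) ⟩
  G α x * suc (G β x)   ∎
  where open ≡-Reasoning
G-⊗ α (lim f) x = G-⊗ α (f x) x

G-⊛ : ∀ α β x → G (α ⊛ β) x ≡ G α x ^ G β x
G-⊛ α zero    x = refl
G-⊛ α (suc β) x = trans (G-⊗ (α ⊛ β) α x) (trans (cong (_* G α x) (G-⊛ α β x)) (*-comm _ (G α x)))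
G-⊛ α (lim f) x = G-⊛ α (f x) x

G-o : ∀ n x → G (o n) x ≡ n
G-o zero    x = refl
G-o (suc n) x = cong suc (G-o n x)

G-φ : ∀ k β x → G (φ k β) x ≡ Q k x (G β x)
G-φ zero    β       x = trans (G-⊛ ω β x) (cong (_^ G β x) (G-o (suc x) x))
G-φ (suc k) zero    x = iter-map (λ α → G α x) (λ α → G-φ k α x) x zero
G-φ (suc k) (suc β) x = trans (iter-map (λ α → G α x) (λ α → G-φ k α x) x _)
                              (cong (λ z → iter (Q k x) x (suc z)) (G-φ (suc k) β x))
G-φ (suc k) (lim f) x = G-φ (suc k) (f x) x

Q-inflationary : ∀ k x y → y ≤ Q k (suc x) y
Q-inflationary zero    x y       = <⇒≤ (n<[2+m]^n x y)
Q-inflationary (suc k) x zero    = z≤n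
Q-inflationary (suc k) x (suc y) =
  ≤-trans (s≤s (Q-inflationary (suc k) x y)) (iter-inflationary (Q-inflationary k x) (suc x) _)

-- For x = 0 the iteration is empty.
iter-Q-mono : ∀ k → (∀ {x x′ y y′} → x ≤ x′ → y ≤ y′ → Q k x y ≤ Q k x′ y′) →
              x ≤ x′ → y ≤ y′ → iter (Q k x) x y ≤ iter (Q k x′) x′ y′
iter-Q-mono {x′ = zero} k Q-mono z≤n y≤y′ = y≤y′
iter-Q-mono {x} {x′ = suc x′} {y′ = y′} k Q-mono x≤x′ y≤y′ = begin
  iter (Q k x) x _             ≤⟨ iter-mono (Q-mono x≤x′) x y≤y′ ⟩
  iter (Q k (suc x′)) x y′     ≤⟨ iter-mono-count (Q-inflationary k x′) x≤x′ ⟩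
  iter (Q k (suc x′)) (suc x′) y′ ∎
  where open ≤-Reasoning

Q-mono : ∀ k → x ≤ x′ → y ≤ y′ → Q k x y ≤ Q k x′ y′
Q-mono {y′ = y′} zero x≤x′ y≤y′ =
  ≤-trans (^-monoʳ-≤ (suc _) y≤y′) (^-monoˡ-≤ y′ (s≤s x≤x′))
Q-mono (suc k) x≤x′ (z≤n {zero})  = iter-Q-mono k (Q-mono k) x≤x′ z≤n
Q-mono (suc k) x≤x′ (z≤n {suc _}) = iter-Q-mono k (Q-mono k) x≤x′ z≤n
Q-mono (suc k) x≤x′ (s≤s y≤y′)    = iter-Q-mono k (Q-mono k) x≤x′ (s≤s (Q-mono (suc k) x≤x′ y≤y′))

H-inflationary : ∀ k x y → y ≤ H k x y
H-suc-strict : ∀ k x y → H (suc k) x y < H (suc k) x (suc y)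

H-inflationary zero    x y       = <⇒≤ (n<[2+m]^n x y)
H-inflationary (suc k) x zero    = z≤n
H-inflationary (suc k) x (suc y) = ≤-trans (s≤s (H-inflationary (suc k) x y)) (H-suc-strict k x y)

H-suc-strict k x y = s≤s (≤-trans (n≤1+n _) (iter-inflationary (H-inflationary k x) x _))

H-mono : ∀ k x → y ≤ y′ → H k x y ≤ H k x y′
H-mono zero    x y≤y′ = ^-monoʳ-≤ (suc (suc x)) y≤y′
H-mono (suc k) x y≤y′ = mono-from-step (H (suc k) x) (λ y → <⇒≤ (H-suc-strict k x y)) y≤y′

L-⊕ : ∀ α β x → L (α ⊕ β) x ≡ L α x + L β x
L-⊕ α zero    x = sym (+-identityʳ _)
L-⊕ α (suc β) x = trans (cong suc (L-⊕ α β x)) (sym (+-suc _ _))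
L-⊕ α (lim f) x = trans (cong suc (L-⊕ α (f x) x)) (sym (+-suc _ _))

L-⊗-o : ∀ α n x → L (α ⊗ o n) x ≡ n * L α x
L-⊗-o α zero    x = refl
L-⊗-o α (suc n) x = trans (L-⊕ (α ⊗ o n) α x) (trans (cong (_+ L α x) (L-⊗-o α n x)) (+-comm _ (L α x)))

L-ω⊛-positive : ∀ β x → 1 ≤ L (ω ⊛ β) x
L-ω⊛-positive zero    x = s≤s z≤n
L-ω⊛-positive (suc β) x = s≤s z≤n
L-ω⊛-positive (lim f) x = s≤s z≤n

L-ω⊛ : ∀ β x → L (ω ⊛ β) x ≤ suc (suc x) ^ L β x
L-ω⊛ zero    x = ≤-refl
L-ω⊛ (suc β) x = begin
  L (ω ⊛ β ⊗ ω) x                 ≡⟨ cong suc (L-⊗-o (ω ⊛ β) (suc x) x) ⟩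
  suc (suc x * L (ω ⊛ β) x)       ≤⟨ +-monoˡ-≤ (suc x * L (ω ⊛ β) x) (L-ω⊛-positive β x) ⟩
  suc (suc x) * L (ω ⊛ β) x       ≤⟨ *-monoʳ-≤ (suc (suc x)) (L-ω⊛ β x) ⟩
  suc (suc x) ^ L (suc β) x       ∎
  where open ≤-Reasoning
L-ω⊛ (lim f) x = ≤-trans (s≤s (L-ω⊛ (f x) x)) (^-monoʳ-< (suc (suc x)) (s≤s (s≤s z≤n)) (n<1+n (L (f x) x)))

L-φ : ∀ k β x → L (φ k β) x ≤ H k x (L β x)
L-φ zero    β       x = L-ω⊛ β x
L-φ (suc k) zero    x = s≤s (iter-map-≤ (λ α → L α x) (λ α → L-φ k α x) (H-mono k x) x zero)
L-φ (suc k) (suc β) x = s≤s (begin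
  L (iter (φ k) x (suc (φ (suc k) β))) x         ≤⟨ iter-map-≤ (λ α → L α x) (λ α → L-φ k α x) (H-mono k x) x _ ⟩
  iter (H k x) x (suc (L (φ (suc k) β) x))       ≤⟨ iter-mono (H-mono k x) x (s≤s (L-φ (suc k) β x)) ⟩
  iter (H k x) x (suc (H (suc k) x (L β x)))     ∎)
  where open ≤-Reasoning
L-φ (suc k) (lim f) x = ≤-trans (s≤s (L-φ (suc k) (f x) x)) (H-suc-strict k x (L (f x) x))

G-monotone : (α : Ω) → Φω α → Monotone (G α)
G-monotone _ Φ-zero              x y x≤y = z≤n
G-monotone _ (Φ-add {α} {β} p q) x y x≤y = begin
  G (α ⊕ β) x       ≡⟨ G-⊕ α β x ⟩
  G α x + G β x     ≤⟨ +-mono-≤ (G-monotone α p x y x≤y) (G-monotone β q x y x≤y) ⟩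
  G α y + G β y     ≡⟨ sym (G-⊕ α β y) ⟩
  G (α ⊕ β) y       ∎
  where open ≤-Reasoning
G-monotone _ (Φ-phi {α} i p)     x y x≤y = begin
  G (φ i α) x       ≡⟨ G-φ i α x ⟩
  Q i x (G α x)     ≤⟨ Q-mono i x≤y (G-monotone α p x y x≤y) ⟩
  Q i y (G α y)     ≡⟨ sym (G-φ i α y) ⟩
  G (φ i α) y       ∎
  where open ≤-Reasoning

lemma8p4 : ((β : Ω) (k x : ℕ) → (G (φ k β) x ≡ Q k x (G β x)) × (L (φ k β) x ≤ H k x (L β x)))
    × ((α : Ω) → Φω α → Monotone (G α))
lemma8p4 = (λ β k x → G-φ k β x , L-φ k β x) , G-monotone
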